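{- Let $G$ be a finite simple undirected graph with $n\ge1$ vertices, $m$ edges, and average degree $\delta=2m/n\ge\log_2 n$. Let $t_0$ be the unique positive real solution of $t+\log_2 t=0$ (so $\sqrt{t_0}=0.8007\ldots$). Then $$\chi_o(G)\ge\sqrt{t_0}\,\sqrt{n}=0.8007\ldots\sqrt{n}.$$
   Context: An orientation of an undirected graph $G$ is an oriented graph (a directed graph with no parallel and no antiparallel arcs) whose underlying undirected graph is $G$. An oriented colouring of an oriented graph $D$ is a proper vertex colouring $c$ of its underlying graph such that there are no arcs $vw$ and $xy$ (directed from $v$ to $w$ and from $x$ to $y$) with $c(v)=c(y)$ and $c(w)=c(x)$. $\chi_o(D)$ is the minimum number of colours in an oriented colouring of $D$, and the oriented chromatic number $\chi_o(G)$ of an undirected graph $G$ is the maximum of $\chi_o(D)$ over all orientations $D$ of $G$. -}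

module Defs where

open import Data.Nat using (ℕ; zero; suc; _+_; _*_; _^_; _≤_; _<ᵇ_)
open import Data.Bool using (Bool; true; false; if_then_else_; _∧_)
open import Data.Fin using (Fin; toℕ)
open import Data.List using (List; map; allFin)
open import Data.Nat.ListAction using (sum)
open import Data.Product using (_×_; Σ; ∃)
open import Data.Sum using (_⊎_)
open import Relation.Binary.PropositionalEquality using (_≡_; _≢_)
open import Relation.Nullary using (¬_)
open import Data.Empty using (⊥)

record SimpleGraph (n : ℕ) : Set where
  field
    Adj     : Fin n → Fin n → Bool
    symm    : ∀ u v → Adj u v ≡ Adj v u
    irrefl  : ∀ v → Adj v v ≡ false
open SimpleGraph public

edgeCount : ∀ {n} → SimpleGraph n → ℕ
edgeCount {n} G =
  sum (map (λ i → sum (map (λ j → if (toℕ i <ᵇ toℕ j) ∧ Adj G i j then 1 else 0)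
                           (allFin n)))
           (allFin n))

record Orientation {n : ℕ} (G : SimpleGraph n) : Set where
  field
    Arc        : Fin n → Fin n → Bool
    arc⇒edge   : ∀ u v → Arc u v ≡ true → Adj G u v ≡ true
    edge⇒arc   : ∀ u v → Adj G u v ≡ true → (Arc u v ≡ true) ⊎ (Arc v u ≡ true)
    antisym    : ∀ u v → Arc u v ≡ true → Arc v u ≡ true → ⊥
open Orientation public

IsOrientedColouring : ∀ {n} {G : SimpleGraph n} → Orientation G → (k : ℕ) → (Fin n → Fin k) → Set
IsOrientedColouring {n} {G} D k c =
  (∀ u v → Adj G u v ≡ true → c u ≢ c v)
  × (∀ v w x y → Arc D v w ≡ true → Arc D x y ≡ true → ¬ ((c v ≡ c y) × (c w ≡ c x)))

-- "average degree 2m/n ≥ log₂ n", for n ≥ 1, is exactly 2^(2m) ≥ n^n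
-- (raise 2^(2m/n) ≥ n to the n-th power); stated over ℕ.
AvgDegreeAtLeastLog₂ : (n m : ℕ) → Set
AvgDegreeAtLeastLog₂ n m = n ^ n ≤ 2 ^ (2 * m)

-- "k ≥ √t₀ · √n", i.e. k² ≥ t₀ n, where t₀ > 0 is the unique solution of
-- t + log₂ t = 0.  Since t ↦ t + log₂ t is strictly increasing, for x = k²/n > 0
-- we have x ≥ t₀ ⇔ x + log₂ x ≥ 0 ⇔ x · 2^x ≥ 1 ⇔ 2^(k²) · k^(2n) ≥ n^n
-- (for k = 0 both sides are false as n ≥ 1).
AtLeastSqrtT₀SqrtN : (n k : ℕ) → Set
AtLeastSqrtT₀SqrtN n k = n ^ n ≤ 2 ^ (k * k) * k ^ (2 * n)

-- Let K be the largest k with 2^(k²) k^(2n) < n^n. For an oriented K-colouring c of an orientation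
-- of G, the arcs between colour classes form an oriented graph on the colours, which extends to a
-- tournament t, and every edge {i, j} is oriented as t orients c i and c j. Hence at most
-- K^n · 2^(K choose 2) orientations of G have an oriented K-colouring, and by the choice of K and
-- 2m/n ≥ log₂ n this is less than 2^m, the number of orientations of G. An orientation avoiding
-- all these colour patterns is built edge by edge: split the patterns by their value on the
-- first edge, avoid the half with fewer than 2^(m-1) members on the remaining edges, and orient
-- the first edge against the other half.

module Submission where

open import Defs
open import Data.Nat using (ℕ; _≥_)
open import Data.Fin using (Fin)
open import Data.Product using (Σ)

open import Data.Bool using (Bool; true; false; not; _∧_; if_then_else_; T)
open import Data.Bool.Properties using (not-involutive; not-¬; T-≡; T-∧) renaming (_≟_ to _≟ᵇ_)
open import Data.Empty using (⊥; ⊥-elim)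
open import Data.Fin using (toℕ; zero; suc; inject≤)
open import Data.Fin.Properties using (toℕ-injective; any?; inject≤-injective) renaming (_≟_ to _≟ᶠ_)
open import Data.List using (List; []; _∷_; _++_; length; map; filter; filterᵇ; allFin; cartesianProduct; cartesianProductWith)
open import Data.List.Membership.Propositional using (_∈_)
open import Data.List.Membership.Propositional.Properties using (∈-cartesianProductWith⁺; ∈-filter⁻; ∈-allFin)
open import Data.List.Properties using (map-++; map-∘; length-++; length-map; length-tabulate)
open import Data.List.Relation.Unary.All as All using (All; [])
open import Data.List.Relation.Unary.All.Properties using (all-filter; filter⁻)
open import Data.List.Relation.Unary.AllPairs using (_∷_)
open import Data.List.Relation.Unary.Any using (here; there)
open import Data.List.Relation.Unary.Unique.Propositional using (Unique; [])
open import Data.List.Relation.Unary.Unique.Propositional.Properties using (allFin⁺; cartesianProduct⁺) renaming (filter⁺ to Unique-filter⁺)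
open import Data.Nat using (zero; suc; _+_; _*_; _^_; _≤_; _<_; _<ᵇ_; s≤s)
open import Data.Nat.ListAction using (sum)
open import Data.Nat.ListAction.Properties using (sum-++)
open import Data.Nat.Properties
open import Data.Nat.Solver using (module +-*-Solver)
open import Data.Product using (∃-syntax; _×_; _,_; proj₁; proj₂; map₂)
open import Data.Product.Properties using (≡-dec)
open import Data.Sum using (_⊎_; inj₁; inj₂)
open import Data.Unit using (⊤; tt)
open import Data.Vec using (Vec; []; _∷_; lookup; tabulate)
open import Data.Vec.Properties using (lookup∘tabulate)
open import Function using (_∘_; const; id)
open import Function.Bundles using (Equivalence)
open import Relation.Binary.Definitions using (DecidableEquality; Asymmetric)
import Relation.Binary.Definitions as Binary
open import Relation.Binary.PropositionalEquality
open import Relation.Nullary using (¬_; Dec; yes; no; does; ¬?)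
open import Relation.Nullary.Decidable using (T?; dec-true; dec-false; _×-dec_)
open import Relation.Nullary.Reflects using (ofʸ; ofⁿ)
open import Relation.Unary using (Decidable)

length-filter-¬ : ∀ {A : Set} {P : A → Set} (P? : Decidable P) xs →
                  length (filter P? xs) + length (filter (¬? ∘ P?) xs) ≡ length xs
length-filter-¬ P? [] = refl
length-filter-¬ P? (x ∷ xs) with does (P? x)
... | true = cong suc (length-filter-¬ P? xs)
... | false = trans (+-suc _ _) (cong suc (length-filter-¬ P? xs))

length-filterᵇ : ∀ {A : Set} (p : A → Bool) xs →
                 length (filterᵇ p xs) ≡ sum (map (λ x → if p x then 1 else 0) xs)
length-filterᵇ p [] = refl
length-filterᵇ p (x ∷ xs) with p x
... | true = cong suc (length-filterᵇ p xs)
... | false = length-filterᵇ p xs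

sum-map-cartesianProduct : ∀ {A B : Set} (w : A × B → ℕ) xs ys →
  sum (map w (cartesianProduct xs ys)) ≡ sum (map (λ x → sum (map (λ y → w (x , y)) ys)) xs)
sum-map-cartesianProduct w [] ys = refl
sum-map-cartesianProduct w (x ∷ xs) ys = begin
  sum (map w (map (x ,_) ys ++ cartesianProduct xs ys))
    ≡⟨ cong sum (map-++ w (map (x ,_) ys) _) ⟩
  sum (map w (map (x ,_) ys) ++ map w (cartesianProduct xs ys))
    ≡⟨ sum-++ (map w (map (x ,_) ys)) _ ⟩
  sum (map w (map (x ,_) ys)) + sum (map w (cartesianProduct xs ys))
    ≡⟨ cong₂ _+_ (cong sum (sym (map-∘ ys))) (sum-map-cartesianProduct w xs ys) ⟩
  sum (map (λ y → w (x , y)) ys) + sum (map (λ x → sum (map (λ y → w (x , y)) ys)) xs) ∎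
  where open ≡-Reasoning

length-cartesianProductWith : ∀ {A B C : Set} (f : A → B → C) xs ys →
  length (cartesianProductWith f xs ys) ≡ length xs * length ys
length-cartesianProductWith f [] ys = refl
length-cartesianProductWith f (x ∷ xs) ys = begin
  length (map (f x) ys ++ cartesianProductWith f xs ys)
    ≡⟨ length-++ (map (f x) ys) ⟩
  length (map (f x) ys) + length (cartesianProductWith f xs ys)
    ≡⟨ cong₂ _+_ (length-map (f x) ys) (length-cartesianProductWith f xs ys) ⟩
  length ys + length xs * length ys ∎
  where open ≡-Reasoning

vectors : {A : Set} → List A → (n : ℕ) → List (Vec A n)
vectors xs zero = [] ∷ []
vectors xs (suc n) = cartesianProductWith _∷_ xs (vectors xs n)

∈-vectors : ∀ {A : Set} {xs : List A} → (∀ a → a ∈ xs) → ∀ {n} (v : Vec A n) → v ∈ vectors xs n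
∈-vectors _∈xs [] = here refl
∈-vectors _∈xs (a ∷ v) = ∈-cartesianProductWith⁺ _∷_ (a ∈xs) (∈-vectors _∈xs v)

length-vectors : ∀ {A : Set} (xs : List A) n → length (vectors xs n) ≡ length xs ^ n
length-vectors xs zero = refl
length-vectors xs (suc n) =
  trans (length-cartesianProductWith _∷_ xs (vectors xs n)) (cong (length xs *_) (length-vectors xs n))

Avoids : {X : Set} → List X → (X → Bool) → List (X → Bool) → Set
Avoids ps s fs = All (λ f → ∃[ p ] p ∈ ps × s p ≢ f p) fs

module _ {X : Set} (_≟_ : DecidableEquality X) where

  update : (X → Bool) → X → Bool → X → Bool
  update s p b x = if does (x ≟ p) then b else s x

  update-≡ : ∀ s p b → update s p b p ≡ b
  update-≡ s p b with p ≟ p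
  ... | yes _ = refl
  ... | no p≢p = ⊥-elim (p≢p refl)

  update-≢ : ∀ s {p} b {x} → x ≢ p → update s p b x ≡ s x
  update-≢ s {p} b {x} x≢p with x ≟ p
  ... | yes x≡p = ⊥-elim (x≢p x≡p)
  ... | no _ = refl

  avoids-∷ : ∀ {p ps} {P : (X → Bool) → Set} (P? : Decidable P) b fs →
             All (p ≢_) ps → (∀ f → ¬ P f → f p ≢ b) →
             ∃[ s ] Avoids ps s (filter P? fs) → ∃[ s ] Avoids (p ∷ ps) s fs
  avoids-∷ {p} {ps} {P} P? b fs p∉ps outside (s , avoids) =
    update s p b , filter⁻ P? (All.map inside avoids) (All.map atHead (all-filter (¬? ∘ P?) fs))
    where
    inside : ∀ {f : X → Bool} → ∃[ q ] q ∈ ps × s q ≢ f q → ∃[ q ] q ∈ p ∷ ps × update s p b q ≢ f q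
    inside (q , q∈ps , sq≢fq) =
      q , there q∈ps , sq≢fq ∘ trans (sym (update-≢ s b (≢-sym (All.lookup p∉ps q∈ps))))
    atHead : ∀ {f : X → Bool} → ¬ P f → ∃[ q ] q ∈ p ∷ ps × update s p b q ≢ f q
    atHead {f} ¬Pf = p , here refl , λ sp≡fp → outside f ¬Pf (trans (sym sp≡fp) (update-≡ s p b))

  true-at? : (p : X) → Decidable (λ (f : X → Bool) → f p ≡ true)
  true-at? p f = f p ≟ᵇ true

  avoid : (ps : List X) → Unique ps → (fs : List (X → Bool)) → length fs < 2 ^ length ps →
          ∃[ s ] Avoids ps s fs
  avoid [] [] [] _ = const false , []
  avoid [] [] (_ ∷ _) (s≤s ())
  avoid (p ∷ ps) (p∉ps ∷ ps!) fs |fs|< with length (filter (true-at? p) fs) <? 2 ^ length ps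
  ... | yes few = avoids-∷ (true-at? p) true fs p∉ps (λ _ fp≢true → fp≢true) (avoid ps ps! _ few)
  ... | no many = avoids-∷ (¬? ∘ true-at? p) false fs p∉ps
                    (λ _ ¬fp≢true fp≡false → ¬fp≢true (not-¬ fp≡false)) (avoid ps ps! _ few)
    where
    open ≤-Reasoning
    t = 2 ^ length ps
    few : length (filter (¬? ∘ true-at? p) fs) < t
    few = +-cancelˡ-< t _ t (begin-strict
      t + length (filter (¬? ∘ true-at? p) fs)
        ≤⟨ +-monoˡ-≤ _ (≮⇒≥ many) ⟩
      length (filter (true-at? p) fs) + length (filter (¬? ∘ true-at? p) fs)
        ≡⟨ length-filter-¬ (true-at? p) fs ⟩
      length fs
        <⟨ |fs|< ⟩
      t + (t + 0)
        ≡⟨ cong (t +_) (+-identityʳ t) ⟩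
      t + t ∎)

IsTournament : {A : Set} → (A → A → Bool) → Set
IsTournament d = ∀ a b → a ≢ b → d a b ≡ not (d b a)

module _ {A : Set} {d : A → A → Bool} (d-tour : IsTournament d) {a b : A} (a≢b : a ≢ b) where

  tournament-total : d a b ≡ true ⊎ d b a ≡ true
  tournament-total with d b a | d-tour a b a≢b
  ... | true | _ = inj₂ refl
  ... | false | dab≡true = inj₁ dab≡true

  tournament-asym : d a b ≡ true → d b a ≡ true → ⊥
  tournament-asym dab dba with () ← trans (sym dab) (trans (d-tour a b a≢b) (cong not dba))

-- In a tournament (r , t) on Fin (suc k), lookup r b says whether 0 beats suc b.
Tournament : ℕ → Set
Tournament zero = ⊤
Tournament (suc k) = Vec Bool k × Tournament k

beats : ∀ {k} → Tournament k → Fin k → Fin k → Bool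
beats (r , t) zero zero = false
beats (r , t) zero (suc b) = lookup r b
beats (r , t) (suc a) zero = not (lookup r a)
beats (r , t) (suc a) (suc b) = beats t a b

beats-isTournament : ∀ {k} (t : Tournament k) → IsTournament (beats t)
beats-isTournament (r , t) zero zero 0≢0 = ⊥-elim (0≢0 refl)
beats-isTournament (r , t) zero (suc b) _ = sym (not-involutive _)
beats-isTournament (r , t) (suc a) zero _ = refl
beats-isTournament (r , t) (suc a) (suc b) a≢b = beats-isTournament t a b (a≢b ∘ cong suc)

extend-to-tournament : ∀ {k} (R : Fin k → Fin k → Set) → Binary.Decidable R → Asymmetric R →
                       ∃[ t ] (∀ a b → R a b → beats t a b ≡ true)
extend-to-tournament {zero} R R? asym = tt , λ ()
extend-to-tournament {suc k} R R? asym
  with t , R⊆t ← extend-to-tournament (λ a b → R (suc a) (suc b)) (λ a b → R? (suc a) (suc b)) asym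
  = (row , t) , R⊆beats
  where
  row : Vec Bool k
  row = tabulate (λ b → does (R? zero (suc b)))

  R⊆beats : ∀ a b → R a b → beats (row , t) a b ≡ true
  R⊆beats zero zero r = ⊥-elim (asym r r)
  R⊆beats zero (suc b) r = trans (lookup∘tabulate _ b) (dec-true (R? zero (suc b)) r)
  R⊆beats (suc a) zero r = cong not (trans (lookup∘tabulate _ a) (dec-false (R? zero (suc a)) (asym r)))
  R⊆beats (suc a) (suc b) r = R⊆t a b r

binom₂ : ℕ → ℕ
binom₂ zero = 0
binom₂ (suc k) = k + binom₂ k

bools : List Bool
bools = true ∷ false ∷ []

_∈bools : ∀ b → b ∈ bools
true ∈bools = here refl
false ∈bools = there (here refl)

tournaments : (k : ℕ) → List (Tournament k)
tournaments zero = tt ∷ []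
tournaments (suc k) = cartesianProduct (vectors bools k) (tournaments k)

∈-tournaments : ∀ {k} (t : Tournament k) → t ∈ tournaments k
∈-tournaments {zero} tt = here refl
∈-tournaments {suc k} (r , t) = ∈-cartesianProductWith⁺ _,_ (∈-vectors _∈bools r) (∈-tournaments t)

length-tournaments : ∀ k → length (tournaments k) ≡ 2 ^ binom₂ k
length-tournaments zero = refl
length-tournaments (suc k) = begin
  length (cartesianProduct (vectors bools k) (tournaments k))
    ≡⟨ length-cartesianProductWith _,_ (vectors bools k) (tournaments k) ⟩
  length (vectors bools k) * length (tournaments k)
    ≡⟨ cong₂ _*_ (length-vectors bools k) (length-tournaments k) ⟩
  2 ^ k * 2 ^ binom₂ k
    ≡⟨ ^-distribˡ-+-* 2 k (binom₂ k) ⟨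
  2 ^ (k + binom₂ k) ∎
  where open ≡-Reasoning

fromUpper : ∀ {n} → (Fin n × Fin n → Bool) → Fin n → Fin n → Bool
fromUpper s u v = if toℕ u <ᵇ toℕ v then s (u , v) else not (s (v , u))

fromUpper-upper : ∀ {n} s {u v : Fin n} → T (toℕ u <ᵇ toℕ v) → fromUpper s u v ≡ s (u , v)
fromUpper-upper s {u} {v} u<v with toℕ u <ᵇ toℕ v
... | true = refl

fromUpper-isTournament : ∀ {n} s → IsTournament (fromUpper {n} s)
fromUpper-isTournament s u v u≢v
  with toℕ u <ᵇ toℕ v | <ᵇ-reflects-< (toℕ u) (toℕ v) | toℕ v <ᵇ toℕ u | <ᵇ-reflects-< (toℕ v) (toℕ u)
... | true  | ofʸ u<v | true  | ofʸ v<u = ⊥-elim (<-asym u<v v<u)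
... | true  | _       | false | _       = sym (not-involutive _)
... | false | _       | true  | _       = refl
... | false | ofⁿ u≮v | false | ofⁿ v≮u = ⊥-elim (u≢v (toℕ-injective (≤-antisym (≮⇒≥ v≮u) (≮⇒≥ u≮v))))

module _ {n : ℕ} (G : SimpleGraph n) where

  upperEdgeᵇ : Fin n × Fin n → Bool
  upperEdgeᵇ (i , j) = (toℕ i <ᵇ toℕ j) ∧ Adj G i j

  edges : List (Fin n × Fin n)
  edges = filterᵇ upperEdgeᵇ (cartesianProduct (allFin n) (allFin n))

  edges-unique : Unique edges
  edges-unique = Unique-filter⁺ (T? ∘ upperEdgeᵇ) (cartesianProduct⁺ (allFin⁺ n) (allFin⁺ n))

  ∈-edges⁻ : ∀ {i j} → (i , j) ∈ edges → T (toℕ i <ᵇ toℕ j) × Adj G i j ≡ true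
  ∈-edges⁻ ij∈edges = map₂ (Equivalence.to T-≡) (Equivalence.to T-∧
    (proj₂ (∈-filter⁻ (T? ∘ upperEdgeᵇ) {xs = cartesianProduct (allFin n) (allFin n)} ij∈edges)))

  length-edges : length edges ≡ edgeCount G
  length-edges = trans (length-filterᵇ upperEdgeᵇ (cartesianProduct (allFin n) (allFin n)))
    (sum-map-cartesianProduct (λ e → if upperEdgeᵇ e then 1 else 0) (allFin n) (allFin n))

  adjacent⇒≢ : ∀ {u v} → Adj G u v ≡ true → u ≢ v
  adjacent⇒≢ {u} adj refl with () ← trans (sym adj) (irrefl G u)

  orientationOf : (d : Fin n → Fin n → Bool) → IsTournament d → Orientation G
  orientationOf d d-tour = record
    { Arc = λ u v → Adj G u v ∧ d u v
    ; arc⇒edge = arc⇒adj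
    ; edge⇒arc = adj⇒arc
    ; antisym = arc-asym
    }
    where
    arc⇒adj : ∀ u v → Adj G u v ∧ d u v ≡ true → Adj G u v ≡ true
    arc⇒adj u v arc with Adj G u v
    ... | true = refl

    adj⇒arc : ∀ u v → Adj G u v ≡ true → (Adj G u v ∧ d u v ≡ true) ⊎ (Adj G v u ∧ d v u ≡ true)
    adj⇒arc u v adj rewrite adj | trans (symm G v u) adj = tournament-total d-tour (adjacent⇒≢ adj)

    arc-asym : ∀ u v → Adj G u v ∧ d u v ≡ true → Adj G v u ∧ d v u ≡ true → ⊥
    arc-asym u v arc arc' with Adj G u v in adj | Adj G v u
    ... | true | true = tournament-asym d-tour (adjacent⇒≢ adj) arc arc'

  homomorphism⇒agrees-on-edges : ∀ {d} (d-tour : IsTournament d) {k} {c : Fin n → Fin k} {t} →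
    IsTournament t → (∀ u v → Adj G u v ≡ true → c u ≢ c v) →
    (∀ u v → Arc (orientationOf d d-tour) u v ≡ true → t (c u) (c v) ≡ true) →
    ∀ u v → Adj G u v ≡ true → t (c u) (c v) ≡ d u v
  homomorphism⇒agrees-on-edges {d} d-tour {c = c} {t} t-tour proper hom u v adj with d u v in duv
  ... | true = hom u v (cong₂ _∧_ adj duv)
  ... | false = begin
    t (c u) (c v)        ≡⟨ t-tour (c u) (c v) (proper u v adj) ⟩
    not (t (c v) (c u))  ≡⟨ cong not (hom v u (cong₂ _∧_ (trans (symm G v u) adj) dvu)) ⟩
    false                ∎
    where
    open ≡-Reasoning
    dvu : d v u ≡ true
    dvu = trans (d-tour v u (≢-sym (adjacent⇒≢ adj))) (cong not duv)

module _ {n : ℕ} {G : SimpleGraph n} (D : Orientation G) {k : ℕ} (c : Fin n → Fin k) where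

  ArcBetween : Fin k → Fin k → Set
  ArcBetween a b = ∃[ u ] ∃[ v ] c u ≡ a × c v ≡ b × Arc D u v ≡ true

  arcBetween? : Binary.Decidable ArcBetween
  arcBetween? a b = any? λ u → any? λ v → c u ≟ᶠ a ×-dec c v ≟ᶠ b ×-dec Arc D u v ≟ᵇ true

  arcBetween-asym : IsOrientedColouring D k c → Asymmetric ArcBetween
  arcBetween-asym (_ , oriented) (u , v , refl , refl , uv) (x , y , cx≡cv , cy≡cu , xy) =
    oriented u v x y uv xy (sym cy≡cu , sym cx≡cv)

  orientedColouring⇒homomorphism : IsOrientedColouring D k c →
    ∃[ t ] (∀ u v → Arc D u v ≡ true → beats t (c u) (c v) ≡ true)
  orientedColouring⇒homomorphism col
    with t , ArcBetween⊆t ← extend-to-tournament ArcBetween arcBetween? (arcBetween-asym col)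
    = t , λ u v uv → ArcBetween⊆t (c u) (c v) (u , v , refl , refl , uv)

orientedColouring-inject≤ : ∀ {n} {G : SimpleGraph n} {D : Orientation G} {k K} {c : Fin n → Fin k} →
  (k≤K : k ≤ K) → IsOrientedColouring D k c → IsOrientedColouring D K (λ u → inject≤ (c u) k≤K)
orientedColouring-inject≤ k≤K (proper , oriented) =
  (λ u v adj → proper u v adj ∘ injective) ,
  (λ v w x y vw xy (cv≡cy , cw≡cx) → oriented v w x y vw xy (injective cv≡cy , injective cw≡cx))
  where
  injective : ∀ {a b} → inject≤ a k≤K ≡ inject≤ b k≤K → a ≡ b
  injective = inject≤-injective k≤K k≤K _ _

colourPattern : ∀ {n k} → Vec (Fin k) n → Tournament k → Fin n × Fin n → Bool
colourPattern v t (i , j) = beats t (lookup v i) (lookup v j)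

colourPatterns : (n k : ℕ) → List (Fin n × Fin n → Bool)
colourPatterns n k = cartesianProductWith colourPattern (vectors (allFin k) n) (tournaments k)

length-colourPatterns : ∀ n k → length (colourPatterns n k) ≡ k ^ n * 2 ^ binom₂ k
length-colourPatterns n k = begin
  length (colourPatterns n k)
    ≡⟨ length-cartesianProductWith colourPattern (vectors (allFin k) n) (tournaments k) ⟩
  length (vectors (allFin k) n) * length (tournaments k)
    ≡⟨ cong₂ _*_ (length-vectors (allFin k) n) (length-tournaments k) ⟩
  length (allFin k) ^ n * 2 ^ binom₂ k
    ≡⟨ cong (λ m → m ^ n * 2 ^ binom₂ k) (length-tabulate id) ⟩
  k ^ n * 2 ^ binom₂ k ∎
  where open ≡-Reasoning

avoiding⇒¬orientedColouring : ∀ {n k} (G : SimpleGraph n) {s} → Avoids (edges G) s (colourPatterns n k) →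
  (c : Fin n → Fin k) → ¬ IsOrientedColouring (orientationOf G (fromUpper s) (fromUpper-isTournament s)) k c
avoiding⇒¬orientedColouring G {s} avoids c col
  with t , hom ← orientedColouring⇒homomorphism (orientationOf G (fromUpper s) (fromUpper-isTournament s)) c col
  with (i , j) , ij∈edges , s≢pattern ← All.lookup avoids
         (∈-cartesianProductWith⁺ colourPattern (∈-vectors ∈-allFin (tabulate c)) (∈-tournaments t))
  with i<j , adj ← ∈-edges⁻ G ij∈edges
  = s≢pattern (begin
  s (i , j)                             ≡⟨ fromUpper-upper s i<j ⟨
  fromUpper s i j                       ≡⟨ agrees i j adj ⟨
  beats t (c i) (c j)                   ≡⟨ cong₂ (beats t) (lookup∘tabulate c i) (lookup∘tabulate c j) ⟨
  colourPattern (tabulate c) t (i , j)  ∎)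
  where
  open ≡-Reasoning
  agrees = homomorphism⇒agrees-on-edges G (fromUpper-isTournament s) (beats-isTournament t) (proj₁ col) hom

BelowBound : ℕ → ℕ → Set
BelowBound n k = 2 ^ (k * k) * k ^ (2 * n) < n ^ n

belowBound? : ∀ n k → Dec (BelowBound n k)
belowBound? n k = 2 ^ (k * k) * k ^ (2 * n) <? n ^ n

belowBound-zero : ∀ {n} → n ≥ 1 → BelowBound n 0
belowBound-zero {suc n} _ = m^n>0 (suc n) (suc n)

<⇒¬belowBound : ∀ {n k} → n < k → ¬ BelowBound n k
<⇒¬belowBound {n} {k@(suc _)} n<k below = <⇒≱ below (begin
  n ^ n                        ≤⟨ ^-monoˡ-≤ n (<⇒≤ n<k) ⟩
  k ^ n                        ≤⟨ ^-monoʳ-≤ k (m≤m+n n (n + 0)) ⟩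
  k ^ (2 * n)                  ≤⟨ m≤n*m (k ^ (2 * n)) (2 ^ (k * k)) {{m^n≢0 2 (k * k)}} ⟩
  2 ^ (k * k) * k ^ (2 * n)    ∎)
  where open ≤-Reasoning

greatest : ∀ {P : ℕ → Set} → Decidable P → P 0 → ∀ B → (∀ k → B < k → ¬ P k) →
           ∃[ K ] P K × (∀ k → P k → k ≤ K)
greatest P? P0 zero bounded = 0 , P0 , λ k Pk → ≮⇒≥ λ 0<k → bounded k 0<k Pk
greatest {P} P? P0 (suc B) bounded with P? (suc B)
... | yes PsB = suc B , PsB , λ k Pk → ≮⇒≥ λ sB<k → bounded k sB<k Pk
... | no ¬PsB = greatest P? P0 B bounded′
  where
  bounded′ : ∀ k → B < k → ¬ P k
  bounded′ k B<k with m≤n⇒m<n∨m≡n B<k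
  ... | inj₁ sB<k = bounded k sB<k
  ... | inj₂ refl = ¬PsB

binom₂+binom₂+k≡k*k : ∀ k → binom₂ k + binom₂ k + k ≡ k * k
binom₂+binom₂+k≡k*k zero = refl
binom₂+binom₂+k≡k*k (suc k) = begin
  (k + b) + (k + b) + suc k  ≡⟨ solve 2 (λ k b → (k :+ b) :+ (k :+ b) :+ (con 1 :+ k)
                                              := (b :+ b :+ k) :+ (con 1 :+ k :+ k)) refl k b ⟩
  (b + b + k) + (suc k + k)  ≡⟨ cong (_+ (suc k + k)) (binom₂+binom₂+k≡k*k k) ⟩
  k * k + (suc k + k)        ≡⟨ solve 1 (λ k → k :* k :+ (con 1 :+ k :+ k) := (con 1 :+ k) :* (con 1 :+ k)) refl k ⟩
  suc k * suc k              ∎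
  where
  open ≡-Reasoning
  open +-*-Solver
  b = binom₂ k

m^[2*n]≡m^n*m^n : ∀ m n → m ^ (2 * n) ≡ m ^ n * m ^ n
m^[2*n]≡m^n*m^n m n = trans (cong (λ o → m ^ (n + o)) (+-identityʳ n)) (^-distribˡ-+-* m n n)

m*m<n*n⇒m<n : ∀ {m n} → m * m < n * n → m < n
m*m<n*n⇒m<n m*m<n*n = ≰⇒> λ n≤m → <⇒≱ m*m<n*n (*-mono-≤ n≤m n≤m)

belowBound⇒fewColourPatterns : ∀ {n k m} → BelowBound n k → AvgDegreeAtLeastLog₂ n m →
                               k ^ n * 2 ^ binom₂ k < 2 ^ m
belowBound⇒fewColourPatterns {n} {k} {m} below avgDegree = m*m<n*n⇒m<n (begin-strict
  (k ^ n * 2 ^ b) * (k ^ n * 2 ^ b)   ≡⟨ [m*n]*[o*p]≡[m*o]*[n*p] (k ^ n) (2 ^ b) (k ^ n) (2 ^ b) ⟩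
  (k ^ n * k ^ n) * (2 ^ b * 2 ^ b)   ≡⟨ cong₂ _*_ (m^[2*n]≡m^n*m^n k n) (^-distribˡ-+-* 2 b b) ⟨
  k ^ (2 * n) * 2 ^ (b + b)           ≤⟨ *-monoʳ-≤ (k ^ (2 * n)) (^-monoʳ-≤ 2 (m≤m+n (b + b) k)) ⟩
  k ^ (2 * n) * 2 ^ (b + b + k)       ≡⟨ cong (λ e → k ^ (2 * n) * 2 ^ e) (binom₂+binom₂+k≡k*k k) ⟩
  k ^ (2 * n) * 2 ^ (k * k)           ≡⟨ *-comm (k ^ (2 * n)) (2 ^ (k * k)) ⟩
  2 ^ (k * k) * k ^ (2 * n)           <⟨ below ⟩
  n ^ n                               ≤⟨ avgDegree ⟩
  2 ^ (2 * m)                         ≡⟨ m^[2*n]≡m^n*m^n 2 m ⟩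
  2 ^ m * 2 ^ m                       ∎)
  where
  open ≤-Reasoning
  b = binom₂ k

lemma4 : (n : ℕ) → n ≥ 1 → (G : SimpleGraph n) → AvgDegreeAtLeastLog₂ n (edgeCount G) → Σ (Orientation G) (λ D → (k : ℕ) → (c : Fin n → Fin k) → IsOrientedColouring D k c → AtLeastSqrtT₀SqrtN n k)
lemma4 n n≥1 G avgDegree
  with K , below-K , K-greatest ← greatest (belowBound? n) (belowBound-zero n≥1) n (λ _ → <⇒¬belowBound)
  with s , avoids ← avoid (≡-dec _≟ᶠ_ _≟ᶠ_) (edges G) (edges-unique G) (colourPatterns n K)
         (subst₂ (λ p e → p < 2 ^ e) (sym (length-colourPatterns n K)) (sym (length-edges G))
                 (belowBound⇒fewColourPatterns {n} {K} {edgeCount G} below-K avgDegree))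
  = D , atLeast
  where
  D : Orientation G
  D = orientationOf G (fromUpper s) (fromUpper-isTournament s)

  atLeast : ∀ k c → IsOrientedColouring D k c → AtLeastSqrtT₀SqrtN n k
  atLeast k c col with belowBound? n k
  ... | no ¬below = ≮⇒≥ ¬below
  ... | yes below = ⊥-elim (avoiding⇒¬orientedColouring G avoids (λ u → inject≤ (c u) k≤K)
                             (orientedColouring-inject≤ {D = D} k≤K col))
    where k≤K = K-greatest k below
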